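{- Let $m,n$ be positive integers, let $e_1,\dots,e_m,f_1,\dots,f_n$ be the standard basis of $\mathbb R^{m+n}$, and $\Delta(m,n)=\{(i|j):=e_i-f_j: 1\le i\le m,\ 1\le j\le n\}$. For nonempty $A\subseteq\{1,\dots,m\}$, $B\subseteq\{1,\dots,n\}$ write $A\times B=\{(i|j):i\in A,j\in B\}$ (a rectangle); a little square is a rectangle with $|A|=|B|=2$ and a triangle is a 3-element subset of a little square. For a subset $S\subseteq\Delta(m,n)$ the following are equivalent: (1) $S$ is complete, i.e. $\mathrm{span}(S)\cap\Delta(m,n)=S$; (2) whenever a triangle is contained in $S$, the little square containing it is contained in $S$; (3) $S=\bigcup_{i=1}^h A_i\times B_i$ for some $h\ge0$ and rectangles $A_i\times B_i$ where the $A_i$ are mutually disjoint and the $B_i$ are mutually disjoint.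
   Formalization: The span in the definition of completeness (1) is taken over the rationals, with the vectors (i|j) lying in ℚ^(m+n) rather than $\mathbb R^{m+n}$. -}

module Defs where

open import Data.Nat using (ℕ)
import Data.Nat as ℕ
open import Data.Bool using (Bool; true; false; if_then_else_; _∧_)
open import Data.Fin using (Fin; _↑ˡ_; _↑ʳ_)
import Data.Fin as Fin
open import Data.Vec using (lookup)
open import Data.Fin.Subset using (Subset; _∈_; ∣_∣; Nonempty; _∩_; ⊥)
open import Data.Product using (Σ; ∃; _×_; _,_)
open import Data.Rational using (ℚ; 0ℚ; 1ℚ; _+_; _*_; _-_)
open import Relation.Nullary using (¬_; does)
open import Relation.Binary.PropositionalEquality using (_≡_)
open import Function.Bundles using (_⇔_)

∑ℚ : ∀ {k} → (Fin k → ℚ) → ℚ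
∑ℚ {ℕ.zero}  f = 0ℚ
∑ℚ {ℕ.suc k} f = f Fin.zero + ∑ℚ (λ i → f (Fin.suc i))

∑ℕ : ∀ {k} → (Fin k → ℕ) → ℕ
∑ℕ {ℕ.zero}  f = 0
∑ℕ {ℕ.suc k} f = f Fin.zero ℕ.+ ∑ℕ (λ i → f (Fin.suc i))

-- Vectors in ℚ^(m+n); coordinates 0..m-1 are the e's, m..m+n-1 the f's.
Vecℚ : ℕ → Set
Vecℚ d = Fin d → ℚ

basis : ∀ {d} → Fin d → Vecℚ d
basis k l = if does (k Fin.≟ l) then 1ℚ else 0ℚ

e : ∀ {m} n → Fin m → Vecℚ (m ℕ.+ n)
e n i = basis (i ↑ˡ n)

f : ∀ m {n} → Fin n → Vecℚ (m ℕ.+ n)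
f m j = basis (m ↑ʳ j)

root : ∀ {m n} → Fin m → Fin n → Vecℚ (m ℕ.+ n)
root {m} {n} i j k = e n i k - f m j k

-- A subset of Δ(m,n), identified with Fin m × Fin n via (i,j) ↦ (i|j)
-- (this identification is a bijection).
ΔSub : ℕ → ℕ → Set
ΔSub m n = Fin m → Fin n → Bool

_∈Δ_ : ∀ {m n} → Fin m × Fin n → ΔSub m n → Set
(i , j) ∈Δ S = S i j ≡ true

_⊆Δ_ : ∀ {m n} → ΔSub m n → ΔSub m n → Set
T ⊆Δ S = ∀ i j → (i , j) ∈Δ T → (i , j) ∈Δ S

cardΔ : ∀ {m n} → ΔSub m n → ℕ
cardΔ S = ∑ℕ (λ i → ∑ℕ (λ j → if S i j then 1 else 0))

InSpan : ∀ {m n} → ΔSub m n → Vecℚ (m ℕ.+ n) → Set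
InSpan {m} {n} S x =
  Σ (Fin m → Fin n → ℚ) λ c →
    (∀ i j → S i j ≡ false → c i j ≡ 0ℚ) ×
    (∀ k → x k ≡ ∑ℚ (λ i → ∑ℚ (λ j → c i j * root i j k)))

Complete : ∀ {m n} → ΔSub m n → Set
Complete {m} {n} S = ∀ (i : Fin m) (j : Fin n) → (InSpan S (root i j) ⇔ ((i , j) ∈Δ S))

rect : ∀ {m n} → Subset m → Subset n → ΔSub m n
rect A B i j = lookup A i ∧ lookup B j

IsRectangle : ∀ {m n} → Subset m → Subset n → Set
IsRectangle A B = Nonempty A × Nonempty B

IsLittleSquare : ∀ {m n} → Subset m → Subset n → Set
IsLittleSquare A B = ∣ A ∣ ≡ 2 × ∣ B ∣ ≡ 2

TriangleClosed : ∀ {m n} → ΔSub m n → Set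
TriangleClosed {m} {n} S =
  ∀ (A : Subset m) (B : Subset n) → IsLittleSquare A B →
  ∀ (T : ΔSub m n) → cardΔ T ≡ 3 → T ⊆Δ rect A B → T ⊆Δ S → rect A B ⊆Δ S

DisjointRectUnion : ∀ {m n} → ΔSub m n → Set
DisjointRectUnion {m} {n} S =
  Σ ℕ λ h → Σ (Fin h → Subset m) λ A → Σ (Fin h → Subset n) λ B →
    (∀ k → IsRectangle (A k) (B k)) ×
    (∀ k l → ¬ (k ≡ l) → A k ∩ A l ≡ ⊥) ×
    (∀ k l → ¬ (k ≡ l) → B k ∩ B l ≡ ⊥) ×
    (∀ i j → ((i , j) ∈Δ S) ⇔ (∃ λ k → (i ∈ A k) × (j ∈ B k)))

{-# OPTIONS --safe #-}
module Submission where

-- All three conditions are equivalent to closure under fourth corners: whenever (a|b), (a'|b)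
-- and (a|b') lie in S, so does (a'|b').
-- Completeness implies it since (a'|b') = (a'|b) - (a|b) + (a|b').  Conversely, if S is closed
-- and (i|j) ∉ S, the functional taking the value 1 on e_i, on e_a for every row a sharing a
-- column with row i, and on f_b for every column b of row i, vanishes on S, hence on span(S),
-- but not on (i|j).
-- A triangle misses one corner of its little square, which closure adds; conversely, if a
-- fourth corner were missing, S would meet the little square in a triangle.
-- Closure makes "sharing a column" an equivalence relation on the nonempty rows; a class
-- together with the common columns of its rows is a rectangle, and these rectangles are indexed
-- by the least row of each class.  Conversely, two entries of a disjoint union of rectangles
-- sharing a row or a column lie in the same rectangle.

open import Defs
open import Level using (Level)
open import Algebra.Bundles using (CommutativeMonoid; Ring)
open import Data.Nat.Base as ℕ using (ℕ; zero; suc; _≤_; s≤s)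
import Data.Nat.Properties as ℕₚ
open import Data.Rational.Base using (ℚ; 0ℚ; 1ℚ; _+_; _*_; _-_; -_)
import Data.Rational.Properties as ℚₚ
open import Data.Rational.Solver using (module +-*-Solver)
open import Data.Bool.Base using (Bool; true; false; if_then_else_; _∧_)
open import Data.Bool.Properties using (∧-conicalˡ; ∧-conicalʳ; ¬-not) renaming (_≟_ to _≟ᵇ_)
open import Data.Fin.Base using (Fin; zero; suc; _↑ˡ_; _↑ʳ_; inject; fromℕ<; toℕ)
open import Data.Fin.Properties
  using ( _≟_; any?; all?; suc-injective; ¬∀⟶∃¬-smallest
        ; toℕ-injective; toℕ-inject; toℕ-fromℕ<)
open import Data.Fin.Subset using (Subset; _∈_; _∉_; _⊆_; ⁅_⁆; _∪_; _∩_; ∣_∣; ⊥)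
open import Data.Fin.Subset.Properties
  using ( _∈?_; x∈⁅x⁆; x∈⁅y⁆⇒x≡y; x∈p∪q⁻; x∈p∪q⁺; x∈p∩q⁻; x∈p∩q⁺; ∉⊥; Empty-unique
        ; ∣⁅x⁆∣≡1; p⊆q⇒∣p∣≤∣q∣; p⊂q⇒∣p∣<∣q∣; ⊆-antisym)
open import Data.Vec.Base using ([]; _∷_; tabulate)
open import Data.Vec.Properties using (lookup⇒[]=; []=⇒lookup; lookup∘tabulate)
open import Data.Vec.Functional using (Vector; _++_)
open import Data.Vec.Functional.Properties using (lookup-++ˡ; lookup-++ʳ)
open import Data.Product.Base using (∃; _×_; _,_; proj₁; map; map₂)
open import Data.Sum.Base using (_⊎_; inj₁; inj₂; [_,_])
open import Function.Base using (_∘_)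
open import Function.Bundles using (_⇔_; mk⇔; Equivalence)
open import Function.Construct.Composition using (_⇔-∘_)
open import Function.Construct.Symmetry using (⇔-sym)
open import Function.Definitions using (Injective)
open import Relation.Nullary using (¬_; Dec; does; yes; no; ¬?; contradiction; _×-dec_; _⊎-dec_; _→-dec_)
open import Relation.Nullary.Decidable using (dec-true; dec-false; decidable-stable)
open import Relation.Unary using (Pred; Decidable)
open import Relation.Binary.PropositionalEquality
  using (_≡_; _≢_; refl; sym; trans; cong; cong₂; subst; subst₂; ≢-sym; module ≡-Reasoning)

private variable ℓ : Level

-- Finite sums

module FinSum {c ℓ} (M : CommutativeMonoid c ℓ) where
  open CommutativeMonoid M renaming (refl to ≈-refl; sym to ≈-sym; trans to ≈-trans)
  open import Algebra.Properties.CommutativeMonoid.Sum M public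
  open import Algebra.Properties.CommutativeSemigroup commutativeSemigroup using (x∙yz≈y∙xz)
  open import Relation.Binary.Reasoning.Setoid setoid

  _without_ : ∀ {k} → Vector Carrier k → Fin k → Vector Carrier k
  (t without p) q = if does (q ≟ p) then ε else t q

  sum-without : ∀ {k} (t : Vector Carrier k) p → sum t ≈ t p ∙ sum (t without p)
  sum-without t zero    = ∙-congˡ (≈-sym (identityˡ _))
  sum-without t (suc p) = begin
    t zero ∙ sum (t ∘ suc)                           ≈⟨ ∙-congˡ (sum-without (t ∘ suc) p) ⟩
    t zero ∙ (t (suc p) ∙ sum ((t ∘ suc) without p)) ≈⟨ x∙yz≈y∙xz _ _ _ ⟩
    t (suc p) ∙ sum (t without suc p)                ∎

  sum-zero : ∀ {k} {t : Vector Carrier k} → (∀ q → t q ≈ ε) → sum t ≈ ε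
  sum-zero {k} t≈ε = ≈-trans (sum-cong-≋ t≈ε) (sum-replicate-zero k)

  sum-single : ∀ {k} {t : Vector Carrier k} p → (∀ q → q ≢ p → t q ≈ ε) → sum t ≈ t p
  sum-single {t = t} p t≈ε = begin
    sum t                   ≈⟨ sum-without t p ⟩
    t p ∙ sum (t without p) ≈⟨ ∙-congˡ (sum-zero rest≈ε) ⟩
    t p ∙ ε                 ≈⟨ identityʳ _ ⟩
    t p                     ∎
    where
    rest≈ε : ∀ q → (t without p) q ≈ ε
    rest≈ε q with q ≟ p
    ... | yes _   = ≈-refl
    ... | no  q≢p = t≈ε q q≢p

  sum-pair : ∀ {k} {t : Vector Carrier k} p p' → p' ≢ p →
             (∀ q → q ≢ p → q ≢ p' → t q ≈ ε) → sum t ≈ t p ∙ t p'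
  sum-pair {t = t} p p' p'≢p t≈ε = begin
    sum t                   ≈⟨ sum-without t p ⟩
    t p ∙ sum (t without p) ≈⟨ ∙-congˡ (sum-single p' rest≈ε) ⟩
    t p ∙ (t without p) p'  ≡⟨ cong (λ b → t p ∙ (if b then ε else t p')) (dec-false (p' ≟ p) p'≢p) ⟩
    t p ∙ t p'              ∎
    where
    rest≈ε : ∀ q → q ≢ p' → (t without p) q ≈ ε
    rest≈ε q q≢p' with q ≟ p
    ... | yes _   = ≈-refl
    ... | no  q≢p = t≈ε q q≢p q≢p'

-- Little squares

module ℕΣ = FinSum ℕₚ.+-0-commutativeMonoid

𝟙 : Bool → ℕ
𝟙 b = if b then 1 else 0

∑ℕ≡sum : ∀ {k} (t : Fin k → ℕ) → ∑ℕ t ≡ ℕΣ.sum t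
∑ℕ≡sum {zero}  t = refl
∑ℕ≡sum {suc k} t = cong (t zero ℕ.+_) (∑ℕ≡sum (t ∘ suc))

∣p∣≡sum : ∀ {k} (p : Subset k) → ∣ p ∣ ≡ ℕΣ.sum (λ x → 𝟙 (does (x ∈? p)))
∣p∣≡sum []          = refl
∣p∣≡sum (true  ∷ p) = cong suc (∣p∣≡sum p)
∣p∣≡sum (false ∷ p) = ∣p∣≡sum p

cardΔ≡sum : ∀ {m n} (T : ΔSub m n) → cardΔ T ≡ ℕΣ.sum (λ x → ℕΣ.sum (λ y → 𝟙 (T x y)))
cardΔ≡sum T =
  trans (∑ℕ≡sum (λ x → ∑ℕ (λ y → 𝟙 (T x y)))) (ℕΣ.sum-cong-≗ (λ x → ∑ℕ≡sum (λ y → 𝟙 (T x y))))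

𝟙-∈ : ∀ {k} {x : Fin k} {p} → x ∈ p → 𝟙 (does (x ∈? p)) ≡ 1
𝟙-∈ {x = x} {p} x∈p = cong 𝟙 (dec-true (x ∈? p) x∈p)

𝟙-∉ : ∀ {k} {x : Fin k} {p} → x ∉ p → 𝟙 (does (x ∈? p)) ≡ 0
𝟙-∉ {x = x} {p} x∉p = cong 𝟙 (dec-false (x ∈? p) x∉p)

pair : ∀ {k} → Fin k → Fin k → Subset k
pair a a' = ⁅ a ⁆ ∪ ⁅ a' ⁆

∈-pairˡ : ∀ {k} (a a' : Fin k) → a ∈ pair a a'
∈-pairˡ a a' = x∈p∪q⁺ (inj₁ (x∈⁅x⁆ a))

∈-pairʳ : ∀ {k} (a a' : Fin k) → a' ∈ pair a a'
∈-pairʳ a a' = x∈p∪q⁺ (inj₂ (x∈⁅x⁆ a'))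

∈-pair⁻ : ∀ {k} {a a' x : Fin k} → x ∈ pair a a' → x ≡ a ⊎ x ≡ a'
∈-pair⁻ {a = a} {a'} x∈ with x∈p∪q⁻ ⁅ a ⁆ ⁅ a' ⁆ x∈
... | inj₁ x∈a  = inj₁ (x∈⁅y⁆⇒x≡y a x∈a)
... | inj₂ x∈a' = inj₂ (x∈⁅y⁆⇒x≡y a' x∈a')

∉-pair : ∀ {k} {a a' x : Fin k} → x ≢ a → x ≢ a' → x ∉ pair a a'
∉-pair x≢a x≢a' x∈ with ∈-pair⁻ x∈
... | inj₁ x≡a  = x≢a x≡a
... | inj₂ x≡a' = x≢a' x≡a'

∣pair∣≡2 : ∀ {k} {a a' : Fin k} → a ≢ a' → ∣ pair a a' ∣ ≡ 2
∣pair∣≡2 {a = a} {a'} a≢a' = begin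
  ∣ pair a a' ∣
    ≡⟨ ∣p∣≡sum (pair a a') ⟩
  ℕΣ.sum (λ x → 𝟙 (does (x ∈? pair a a')))
    ≡⟨ ℕΣ.sum-pair a a' (≢-sym a≢a') (λ x x≢a x≢a' → 𝟙-∉ (∉-pair x≢a x≢a')) ⟩
  𝟙 (does (a ∈? pair a a')) ℕ.+ 𝟙 (does (a' ∈? pair a a'))
    ≡⟨ cong₂ ℕ._+_ (𝟙-∈ (∈-pairˡ a a')) (𝟙-∈ (∈-pairʳ a a')) ⟩
  2 ∎
  where open ≡-Reasoning

∣p∣≡2⇒≡pair : ∀ {k} {p : Subset k} {a} → ∣ p ∣ ≡ 2 → a ∈ p → ∃ λ a' → a ≢ a' × p ≡ pair a a'
∣p∣≡2⇒≡pair {p = p} {a} ∣p∣≡2 a∈p with any? (λ x → (x ∈? p) ×-dec ¬? (a ≟ x))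
... | no ∄a' =
  contradiction (subst₂ _≤_ ∣p∣≡2 (∣⁅x⁆∣≡1 a) (p⊆q⇒∣p∣≤∣q∣ p⊆⁅a⁆)) λ { (s≤s ()) }
  where
  p⊆⁅a⁆ : p ⊆ ⁅ a ⁆
  p⊆⁅a⁆ {x} x∈p =
    subst (_∈ ⁅ a ⁆) (decidable-stable (a ≟ x) λ a≢x → ∄a' (x , x∈p , a≢x)) (x∈⁅x⁆ a)
... | yes (a' , a'∈p , a≢a') = a' , a≢a' , ⊆-antisym p⊆pair pair⊆p
  where
  pair⊆p : pair a a' ⊆ p
  pair⊆p x∈ with ∈-pair⁻ x∈
  ... | inj₁ refl = a∈p
  ... | inj₂ refl = a'∈p
  p⊆pair : p ⊆ pair a a'
  p⊆pair {x} x∈p with x ∈? pair a a'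
  ... | yes x∈pair = x∈pair
  ... | no  x∉pair =
    contradiction (subst₂ ℕ._<_ (∣pair∣≡2 a≢a') ∣p∣≡2 (p⊂q⇒∣p∣<∣q∣ (pair⊆p , x , x∈p , x∉pair)))
                  (ℕₚ.<-irrefl refl)

∈rect⁻ : ∀ {m n} {A : Subset m} {B : Subset n} {x y} → (x , y) ∈Δ rect A B → x ∈ A × y ∈ B
∈rect⁻ {A = A} {B} {x} {y} xy∈ =
  lookup⇒[]= x A (∧-conicalˡ _ _ xy∈) , lookup⇒[]= y B (∧-conicalʳ _ _ xy∈)

∈rect⁺ : ∀ {m n} {A : Subset m} {B : Subset n} {x y} → x ∈ A → y ∈ B → (x , y) ∈Δ rect A B
∈rect⁺ x∈A y∈B = cong₂ _∧_ ([]=⇒lookup x∈A) ([]=⇒lookup y∈B)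

cardΔ-square : ∀ {m n} {T : ΔSub m n} {a a' b b'} → a ≢ a' → b ≢ b' →
               T ⊆Δ rect (pair a a') (pair b b') →
               cardΔ T ≡ (𝟙 (T a b) ℕ.+ 𝟙 (T a b')) ℕ.+ (𝟙 (T a' b) ℕ.+ 𝟙 (T a' b'))
cardΔ-square {T = T} {a} {a'} {b} {b'} a≢a' b≢b' T⊆square = begin
  cardΔ T
    ≡⟨ cardΔ≡sum T ⟩
  ℕΣ.sum (λ x → ℕΣ.sum (λ y → 𝟙 (T x y)))
    ≡⟨ ℕΣ.sum-pair a a' (≢-sym a≢a') empty-row ⟩
  ℕΣ.sum (λ y → 𝟙 (T a y)) ℕ.+ ℕΣ.sum (λ y → 𝟙 (T a' y))
    ≡⟨ cong₂ ℕ._+_ (row a) (row a') ⟩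
  (𝟙 (T a b) ℕ.+ 𝟙 (T a b')) ℕ.+ (𝟙 (T a' b) ℕ.+ 𝟙 (T a' b')) ∎
  where
  open ≡-Reasoning
  outside : ∀ x y → x ∉ pair a a' ⊎ y ∉ pair b b' → T x y ≡ false
  outside x y out = ¬-not λ xy∈T →
    let x∈ , y∈ = ∈rect⁻ (T⊆square x y xy∈T) in [ (λ x∉ → x∉ x∈) , (λ y∉ → y∉ y∈) ] out
  empty-row : ∀ x → x ≢ a → x ≢ a' → ℕΣ.sum (λ y → 𝟙 (T x y)) ≡ 0
  empty-row x x≢a x≢a' = ℕΣ.sum-zero λ y → cong 𝟙 (outside x y (inj₁ (∉-pair x≢a x≢a')))
  row : ∀ x → ℕΣ.sum (λ y → 𝟙 (T x y)) ≡ 𝟙 (T x b) ℕ.+ 𝟙 (T x b')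
  row x = ℕΣ.sum-pair b b' (≢-sym b≢b') λ y y≢b y≢b' → cong 𝟙 (outside x y (inj₂ (∉-pair y≢b y≢b')))

missing-corner : ∀ p q r s → (𝟙 p ℕ.+ 𝟙 q) ℕ.+ (𝟙 r ℕ.+ 𝟙 s) ≡ 3 → p ≡ false →
                 q ≡ true × r ≡ true × s ≡ true
missing-corner false true  true  true  _  _ = refl , refl , refl
missing-corner true  _     _     _     _  ()
missing-corner false true  true  false () _
missing-corner false true  false true  () _
missing-corner false true  false false () _
missing-corner false false true  true  () _
missing-corner false false true  false () _
missing-corner false false false true  () _
missing-corner false false false false () _

CornerClosed : ∀ {m n} → ΔSub m n → Set
CornerClosed S = ∀ a a' b b' → (a , b) ∈Δ S → (a' , b) ∈Δ S → (a , b') ∈Δ S → (a' , b') ∈Δ S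

cornerClosed⇒triangleClosed : ∀ {m n} {S : ΔSub m n} → CornerClosed S → TriangleClosed S
cornerClosed⇒triangleClosed closed A B (∣A∣≡2 , ∣B∣≡2) T ∣T∣≡3 T⊆AB T⊆S i j ij∈AB
  with ∈rect⁻ {A = A} {B} ij∈AB
... | i∈A , j∈B with ∣p∣≡2⇒≡pair {p = A} ∣A∣≡2 i∈A | ∣p∣≡2⇒≡pair {p = B} ∣B∣≡2 j∈B
... | i' , i≢i' , refl | j' , j≢j' , refl with T i j in ij∈T
... | true  = T⊆S i j ij∈T
... | false with missing-corner (T i j) (T i j') (T i' j) (T i' j')
                   (trans (sym (cardΔ-square i≢i' j≢j' T⊆AB)) ∣T∣≡3) ij∈T
... | ij'∈T , i'j∈T , i'j'∈T = closed i' i j' j (T⊆S i' j' i'j'∈T) (T⊆S i j' ij'∈T) (T⊆S i' j i'j∈T)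

triangleClosed⇒cornerClosed : ∀ {m n} {S : ΔSub m n} → TriangleClosed S → CornerClosed S
triangleClosed⇒cornerClosed {m} {n} {S} triangleClosed a a' b b' ab∈S a'b∈S ab'∈S
  with a ≟ a' | b ≟ b'
... | yes refl | _        = ab'∈S
... | no _     | yes refl = a'b∈S
... | no a≢a'  | no b≢b' with S a' b' in a'b'∈S
...   | true  = refl
...   | false = trans (sym a'b'∈S) (triangleClosed (pair a a') (pair b b') (∣pair∣≡2 a≢a' , ∣pair∣≡2 b≢b')
                  T ∣T∣≡3 T⊆square T⊆S a' b' (∈rect⁺ (∈-pairʳ a a') (∈-pairʳ b b')))
  where
  T : ΔSub m n
  T x y = rect (pair a a') (pair b b') x y ∧ S x y
  T⊆square : T ⊆Δ rect (pair a a') (pair b b')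
  T⊆square x y = ∧-conicalˡ _ _
  T⊆S : T ⊆Δ S
  T⊆S x y = ∧-conicalʳ _ _
  corner : ∀ {x y} → x ∈ pair a a' → y ∈ pair b b' → ∀ {v} → S x y ≡ v → 𝟙 (T x y) ≡ 𝟙 v
  corner {x} {y} x∈ y∈ Sxy≡v = cong 𝟙 (trans (cong (_∧ S x y) (∈rect⁺ x∈ y∈)) Sxy≡v)
  ∣T∣≡3 : cardΔ T ≡ 3
  ∣T∣≡3 = trans (cardΔ-square a≢a' b≢b' T⊆square) (cong₂ ℕ._+_
    (cong₂ ℕ._+_ (corner (∈-pairˡ a a') (∈-pairˡ b b') ab∈S)
                 (corner (∈-pairˡ a a') (∈-pairʳ b b') ab'∈S))
    (cong₂ ℕ._+_ (corner (∈-pairʳ a a') (∈-pairˡ b b') a'b∈S)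
                 (corner (∈-pairʳ a a') (∈-pairʳ b b') a'b'∈S)))

triangleClosed⇔cornerClosed : ∀ {m n} (S : ΔSub m n) → TriangleClosed S ⇔ CornerClosed S
triangleClosed⇔cornerClosed S = mk⇔ triangleClosed⇒cornerClosed cornerClosed⇒triangleClosed

module Linking {m n} (S : ΔSub m n) where

  Linked : Fin m → Fin m → Set
  Linked a a' = ∃ λ b → (a , b) ∈Δ S × (a' , b) ∈Δ S

  ∈S? : ∀ a b → Dec ((a , b) ∈Δ S)
  ∈S? a b = S a b ≟ᵇ true

  linked? : ∀ a a' → Dec (Linked a a')
  linked? a a' = any? λ b → ∈S? a b ×-dec ∈S? a' b

  linked-sym : ∀ {a a'} → Linked a a' → Linked a' a
  linked-sym (b , ab∈S , a'b∈S) = b , a'b∈S , ab∈S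

  linked-reflˡ : ∀ {a a'} → Linked a a' → Linked a a
  linked-reflˡ (b , ab∈S , _) = b , ab∈S , ab∈S

  linked-trans : CornerClosed S → ∀ {a a' a''} → Linked a a' → Linked a' a'' → Linked a a''
  linked-trans closed {a} {a'} (b , ab∈S , a'b∈S) (b' , a'b'∈S , a''b'∈S) =
    b' , closed a' a b b' a'b∈S ab∈S a'b'∈S , a''b'∈S

-- Completeness

open import Algebra.Properties.Semiring.Sum (Ring.semiring ℚₚ.+-*-ring)
  using (sum; sum-cong-≗; ∑-comm; ∑-distrib-+; *-distribˡ-sum; *-distribʳ-sum)
open FinSum (Ring.+-commutativeMonoid ℚₚ.+-*-ring) using (sum-zero; sum-single)
open +-*-Solver using (solve; _:+_; _:*_; _:-_; :-_; _:=_; con)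

∑ℚ≡sum : ∀ {k} (t : Fin k → ℚ) → ∑ℚ t ≡ sum t
∑ℚ≡sum {zero}  t = refl
∑ℚ≡sum {suc k} t = cong (t zero +_) (∑ℚ≡sum (t ∘ suc))

𝟙ℚ : Bool → ℚ
𝟙ℚ b = if b then 1ℚ else 0ℚ

basis-refl : ∀ {d} (p : Fin d) → basis p p ≡ 1ℚ
basis-refl p = cong 𝟙ℚ (dec-true (p ≟ p) refl)

basis-≢ : ∀ {d} {p q : Fin d} → p ≢ q → basis p q ≡ 0ℚ
basis-≢ {p = p} {q} p≢q = cong 𝟙ℚ (dec-false (p ≟ q) p≢q)

infix 7 _·_

_·_ : ∀ {d} → Vecℚ d → Vecℚ d → ℚ
u · w = sum λ k → u k * w k

basis-· : ∀ {d} (p : Fin d) (w : Vecℚ d) → basis p · w ≡ w p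
basis-· p w = begin
  basis p · w     ≡⟨ sum-single p off-p ⟩
  basis p p * w p ≡⟨ cong (_* w p) (basis-refl p) ⟩
  1ℚ * w p        ≡⟨ ℚₚ.*-identityˡ (w p) ⟩
  w p             ∎
  where
  open ≡-Reasoning
  off-p : ∀ k → k ≢ p → basis p k * w k ≡ 0ℚ
  off-p k k≢p = trans (cong (_* w k) (basis-≢ (≢-sym k≢p))) (ℚₚ.*-zeroˡ (w k))

·-distribʳ-sub : ∀ {d} (u u' w : Vecℚ d) → (λ k → u k - u' k) · w ≡ u · w - u' · w
·-distribʳ-sub u u' w = begin
  sum (λ k → (u k - u' k) * w k)
    ≡⟨ sum-cong-≗ (λ k → solve 3 (λ x x' y → (x :- x') :* y := x :* y :+ (:- con 1ℚ) :* (x' :* y))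
                                 refl (u k) (u' k) (w k)) ⟩
  sum (λ k → u k * w k + (- 1ℚ) * (u' k * w k))
    ≡⟨ ∑-distrib-+ (λ k → u k * w k) (λ k → (- 1ℚ) * (u' k * w k)) ⟩
  u · w + sum (λ k → (- 1ℚ) * (u' k * w k))
    ≡⟨ cong (u · w +_) (*-distribˡ-sum (- 1ℚ) (λ k → u' k * w k)) ⟨
  u · w + (- 1ℚ) * (u' · w)
    ≡⟨ solve 2 (λ x y → x :+ (:- con 1ℚ) :* y := x :- y) refl (u · w) (u' · w) ⟩
  u · w - u' · w ∎
  where open ≡-Reasoning

root-· : ∀ {m n} (i : Fin m) (j : Fin n) (w : Vecℚ (m ℕ.+ n)) → root i j · w ≡ w (i ↑ˡ n) - w (m ↑ʳ j)
root-· {m} {n} i j w =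
  trans (·-distribʳ-sub (e n i) (f m j) w) (cong₂ _-_ (basis-· (i ↑ˡ n) w) (basis-· (m ↑ʳ j) w))

combination : ∀ {m n d} → (Fin m → Fin n → ℚ) → (Fin m → Fin n → Vecℚ d) → Vecℚ d
combination c v k = sum λ i → sum λ j → c i j * v i j k

∑ℚ∑ℚ≡combination : ∀ {m n d} c (v : Fin m → Fin n → Vecℚ d) k →
                   ∑ℚ (λ i → ∑ℚ (λ j → c i j * v i j k)) ≡ combination c v k
∑ℚ∑ℚ≡combination c v k =
  trans (∑ℚ≡sum (λ i → ∑ℚ (λ j → c i j * v i j k))) (sum-cong-≗ λ i → ∑ℚ≡sum (λ j → c i j * v i j k))

combination-+ : ∀ {m n d} c c' (v : Fin m → Fin n → Vecℚ d) k →
                combination (λ i j → c i j + c' i j) v k ≡ combination c v k + combination c' v k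
combination-+ c c' v k = begin
  sum (λ i → sum λ j → (c i j + c' i j) * v i j k)
    ≡⟨ sum-cong-≗ (λ i → sum-cong-≗ λ j → ℚₚ.*-distribʳ-+ (v i j k) (c i j) (c' i j)) ⟩
  sum (λ i → sum λ j → c i j * v i j k + c' i j * v i j k)
    ≡⟨ sum-cong-≗ (λ i → ∑-distrib-+ (λ j → c i j * v i j k) (λ j → c' i j * v i j k)) ⟩
  sum (λ i → sum (λ j → c i j * v i j k) + sum (λ j → c' i j * v i j k))
    ≡⟨ ∑-distrib-+ (λ i → sum (λ j → c i j * v i j k)) (λ i → sum (λ j → c' i j * v i j k)) ⟩
  combination c v k + combination c' v k ∎
  where open ≡-Reasoning

combination-* : ∀ {m n d} a c (v : Fin m → Fin n → Vecℚ d) k →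
                combination (λ i j → a * c i j) v k ≡ a * combination c v k
combination-* a c v k = begin
  sum (λ i → sum λ j → (a * c i j) * v i j k)
    ≡⟨ sum-cong-≗ (λ i → sum-cong-≗ λ j → ℚₚ.*-assoc a (c i j) (v i j k)) ⟩
  sum (λ i → sum λ j → a * (c i j * v i j k))
    ≡⟨ sum-cong-≗ (λ i → *-distribˡ-sum a (λ j → c i j * v i j k)) ⟨
  sum (λ i → a * sum (λ j → c i j * v i j k))
    ≡⟨ *-distribˡ-sum a (λ i → sum (λ j → c i j * v i j k)) ⟨
  a * combination c v k ∎
  where open ≡-Reasoning

unit : ∀ {m n} → Fin m → Fin n → Fin m → Fin n → ℚ
unit i j a b = basis i a * basis j b

combination-unit : ∀ {m n d} i j (v : Fin m → Fin n → Vecℚ d) k → combination (unit i j) v k ≡ v i j k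
combination-unit i j v k = begin
  sum (λ a → sum λ b → (basis i a * basis j b) * v a b k)
    ≡⟨ sum-cong-≗ (λ a → sum-cong-≗ λ b → ℚₚ.*-assoc (basis i a) (basis j b) (v a b k)) ⟩
  sum (λ a → sum λ b → basis i a * (basis j b * v a b k))
    ≡⟨ sum-cong-≗ (λ a → *-distribˡ-sum (basis i a) (λ b → basis j b * v a b k)) ⟨
  basis i · (λ a → basis j · (λ b → v a b k))
    ≡⟨ sum-cong-≗ (λ a → cong (basis i a *_) (basis-· j (λ b → v a b k))) ⟩
  basis i · (λ a → v a j k)
    ≡⟨ basis-· i (λ a → v a j k) ⟩
  v i j k ∎
  where open ≡-Reasoning

combination-· : ∀ {m n d} c (v : Fin m → Fin n → Vecℚ d) w →
                combination c v · w ≡ sum (λ i → sum λ j → c i j * (v i j · w))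
combination-· c v w = begin
  sum (λ k → sum (λ i → sum λ j → c i j * v i j k) * w k)
    ≡⟨ sum-cong-≗ (λ k → *-distribʳ-sum (w k) (λ i → sum λ j → c i j * v i j k)) ⟩
  sum (λ k → sum λ i → sum (λ j → c i j * v i j k) * w k)
    ≡⟨ sum-cong-≗ (λ k → sum-cong-≗ λ i → *-distribʳ-sum (w k) (λ j → c i j * v i j k)) ⟩
  sum (λ k → sum λ i → sum λ j → (c i j * v i j k) * w k)
    ≡⟨ ∑-comm (λ k i → sum λ j → (c i j * v i j k) * w k) ⟩
  sum (λ i → sum λ k → sum λ j → (c i j * v i j k) * w k)
    ≡⟨ sum-cong-≗ (λ i → ∑-comm (λ k j → (c i j * v i j k) * w k)) ⟩
  sum (λ i → sum λ j → sum λ k → (c i j * v i j k) * w k)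
    ≡⟨ sum-cong-≗ (λ i → sum-cong-≗ λ j → sum-cong-≗ λ k → ℚₚ.*-assoc (c i j) (v i j k) (w k)) ⟩
  sum (λ i → sum λ j → sum λ k → c i j * (v i j k * w k))
    ≡⟨ sum-cong-≗ (λ i → sum-cong-≗ λ j → *-distribˡ-sum (c i j) (λ k → v i j k * w k)) ⟨
  sum (λ i → sum λ j → c i j * (v i j · w)) ∎
  where open ≡-Reasoning

module _ {m n} {S : ΔSub m n} where

  span-intro : ∀ {x} c → (∀ i j → S i j ≡ false → c i j ≡ 0ℚ) →
               (∀ k → x k ≡ combination c root k) → InSpan S x
  span-intro c c-supp x≡ = c , c-supp , λ k → trans (x≡ k) (sym (∑ℚ∑ℚ≡combination c root k))

  span-elim : ∀ {x} (x∈ : InSpan S x) k → x k ≡ combination (proj₁ x∈) root k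
  span-elim (c , _ , x≡) k = trans (x≡ k) (∑ℚ∑ℚ≡combination c root k)

  InSpan-≗ : ∀ {x y} → (∀ k → x k ≡ y k) → InSpan S x → InSpan S y
  InSpan-≗ x≗y (c , c-supp , x≡) = c , c-supp , λ k → trans (sym (x≗y k)) (x≡ k)

  InSpan-root : ∀ {i j} → (i , j) ∈Δ S → InSpan S (root i j)
  InSpan-root {i} {j} ij∈S = span-intro (unit i j) unit-supp λ k → sym (combination-unit i j root k)
    where
    unit-supp : ∀ a b → S a b ≡ false → unit i j a b ≡ 0ℚ
    unit-supp a b ab∉S with i ≟ a
    ... | no _ = ℚₚ.*-zeroˡ (basis j b)
    ... | yes refl with j ≟ b
    ...   | no _     = ℚₚ.*-zeroʳ 1ℚ
    ...   | yes refl = contradiction (trans (sym ij∈S) ab∉S) λ ()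

  InSpan-+ : ∀ {x y} → InSpan S x → InSpan S y → InSpan S (λ k → x k + y k)
  InSpan-+ x∈@(c , c-supp , _) y∈@(c' , c'-supp , _) =
    span-intro (λ i j → c i j + c' i j) (λ i j ij∉S → cong₂ _+_ (c-supp i j ij∉S) (c'-supp i j ij∉S))
      λ k → trans (cong₂ _+_ (span-elim x∈ k) (span-elim y∈ k)) (sym (combination-+ c c' root k))

  InSpan-* : ∀ {x} a → InSpan S x → InSpan S (λ k → a * x k)
  InSpan-* a x∈@(c , c-supp , _) =
    span-intro (λ i j → a * c i j) (λ i j ij∉S → trans (cong (a *_) (c-supp i j ij∉S)) (ℚₚ.*-zeroʳ a))
      λ k → trans (cong (a *_) (span-elim x∈ k)) (sym (combination-* a c root k))

  span-annihilated : ∀ {w x} → (∀ i j → (i , j) ∈Δ S → root i j · w ≡ 0ℚ) →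
                     InSpan S x → x · w ≡ 0ℚ
  span-annihilated {w} {x} roots·w≡0 x∈@(c , c-supp , _) = begin
    x · w                                        ≡⟨ sum-cong-≗ (λ k → cong (_* w k) (span-elim x∈ k)) ⟩
    combination c root · w                       ≡⟨ combination-· c root w ⟩
    sum (λ i → sum λ j → c i j * (root i j · w)) ≡⟨ sum-zero (λ i → sum-zero (term i)) ⟩
    0ℚ                                           ∎
    where
    open ≡-Reasoning
    term : ∀ i j → c i j * (root i j · w) ≡ 0ℚ
    term i j with S i j in ij∈S
    ... | true  = trans (cong (c i j *_) (roots·w≡0 i j ij∈S)) (ℚₚ.*-zeroʳ (c i j))
    ... | false = trans (cong (_* (root i j · w)) (c-supp i j ij∈S)) (ℚₚ.*-zeroˡ (root i j · w))

complete⇒cornerClosed : ∀ {m n} {S : ΔSub m n} → Complete S → CornerClosed S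
complete⇒cornerClosed {m} {n} complete a a' b b' ab∈S a'b∈S ab'∈S =
  Equivalence.to (complete a' b') (InSpan-≗ fourth-root
    (InSpan-+ (InSpan-+ (InSpan-root a'b∈S) (InSpan-* (- 1ℚ) (InSpan-root ab∈S))) (InSpan-root ab'∈S)))
  where
  fourth-root : ∀ k → (root a' b k + (- 1ℚ) * root a b k) + root a b' k ≡ root a' b' k
  fourth-root k = solve 4 (λ x' y x y' → ((x' :- y) :+ (:- con 1ℚ) :* (x :- y)) :+ (x :- y') := x' :- y')
                    refl (e n a' k) (f m b k) (e n a k) (f m b' k)

cornerClosed⇒complete : ∀ {m n} {S : ΔSub m n} → CornerClosed S → Complete S
cornerClosed⇒complete {m} {n} {S} closed i j = mk⇔ to InSpan-root
  where
  open Linking S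
  marked? : ∀ a → Dec (a ≡ i ⊎ Linked i a)
  marked? a = a ≟ i ⊎-dec linked? i a
  ρ : Fin m → ℚ
  ρ = 𝟙ℚ ∘ does ∘ marked?
  κ : Fin n → ℚ
  κ = 𝟙ℚ ∘ S i
  w : Vecℚ (m ℕ.+ n)
  w = ρ ++ κ
  root·w : ∀ a b → root a b · w ≡ ρ a - κ b
  root·w a b = trans (root-· a b w) (cong₂ _-_ (lookup-++ˡ ρ κ a) (lookup-++ʳ ρ κ b))
  marked⇔ : ∀ {a b} → (a , b) ∈Δ S → does (marked? a) ≡ S i b
  marked⇔ {a} {b} ab∈S with S i b in ib∈S
  ... | true  = dec-true (marked? a) (inj₂ (b , ib∈S , ab∈S))
  ... | false = dec-false (marked? a) λ where
    (inj₁ refl)             → contradiction (trans (sym ab∈S) ib∈S) λ ()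
    (inj₂ (b₀ , ib₀ , ab₀)) → contradiction (trans (sym (closed a i b₀ b ab₀ ib₀ ab∈S)) ib∈S) λ ()
  roots·w≡0 : ∀ a b → (a , b) ∈Δ S → root a b · w ≡ 0ℚ
  roots·w≡0 a b ab∈S =
    trans (root·w a b) (trans (cong (λ x → 𝟙ℚ x - κ b) (marked⇔ ab∈S)) (ℚₚ.+-inverseʳ (κ b)))
  to : InSpan S (root i j) → (i , j) ∈Δ S
  to ij∈span with S i j in ij∉S
  ... | true  = refl
  ... | false = contradiction (trans (sym root·w≡1) (span-annihilated roots·w≡0 ij∈span)) ℚₚ.1≢0
    where
    root·w≡1 : root i j · w ≡ 1ℚ
    root·w≡1 =
      trans (root·w i j) (cong₂ (λ x y → 𝟙ℚ x - 𝟙ℚ y) (dec-true (marked? i) (inj₁ refl)) ij∉S)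

complete⇔cornerClosed : ∀ {m n} (S : ΔSub m n) → Complete S ⇔ CornerClosed S
complete⇔cornerClosed S = mk⇔ complete⇒cornerClosed cornerClosed⇒complete

-- Rectangle decompositions

record Enumeration {n} (P : Pred (Fin n) ℓ) : Set ℓ where
  field
    size      : ℕ
    elem      : Fin size → Fin n
    injective : Injective _≡_ _≡_ elem
    sound     : ∀ k → P (elem k)
    complete  : ∀ {i} → P i → ∃ λ k → elem k ≡ i

module _ {n} {P : Pred (Fin (suc n)) ℓ} (E : Enumeration (P ∘ suc)) where
  open Enumeration E

  enumeration-skip : ¬ P zero → Enumeration P
  enumeration-skip ¬P0 = record
    { size = size ; elem = suc ∘ elem ; injective = injective ∘ suc-injective ; sound = sound ; complete = complete′ }
    where
    complete′ : ∀ {i} → P i → ∃ λ k → suc (elem k) ≡ i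
    complete′ {zero}  P0 = contradiction P0 ¬P0
    complete′ {suc i} Pi = map₂ (cong suc) (complete Pi)

  enumeration-cons : P zero → Enumeration P
  enumeration-cons P0 = record
    { size = suc size ; elem = elem′ ; injective = injective′ ; sound = sound′ ; complete = complete′ }
    where
    elem′ : Fin (suc size) → Fin (suc n)
    elem′ zero    = zero
    elem′ (suc k) = suc (elem k)
    injective′ : Injective _≡_ _≡_ elem′
    injective′ {zero}  {zero}  _  = refl
    injective′ {suc k} {suc l} eq = cong suc (injective (suc-injective eq))
    injective′ {zero}  {suc _} ()
    injective′ {suc _} {zero}  ()
    sound′ : ∀ k → P (elem′ k)
    sound′ zero    = P0
    sound′ (suc k) = sound k
    complete′ : ∀ {i} → P i → ∃ λ k → elem′ k ≡ i
    complete′ {zero}  _  = zero , refl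
    complete′ {suc i} Pi = map suc (cong suc) (complete Pi)

enumerate : ∀ {n} {P : Pred (Fin n) ℓ} → Decidable P → Enumeration P
enumerate {n = zero}  P? = record
  { size = 0 ; elem = λ () ; injective = λ { {()} } ; sound = λ () ; complete = λ { {()} } }
enumerate {n = suc n} P? with P? zero
... | yes P0 = enumeration-cons (enumerate (P? ∘ suc)) P0
... | no ¬P0 = enumeration-skip (enumerate (P? ∘ suc)) ¬P0

subsetOf : ∀ {k} {P : Pred (Fin k) ℓ} → Decidable P → Subset k
subsetOf P? = tabulate (does ∘ P?)

∈-subsetOf⁺ : ∀ {k} {P : Pred (Fin k) ℓ} (P? : Decidable P) {x} → P x → x ∈ subsetOf P?
∈-subsetOf⁺ P? {x} Px =
  lookup⇒[]= x (subsetOf P?) (trans (lookup∘tabulate (does ∘ P?) x) (dec-true (P? x) Px))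

∈-subsetOf⁻ : ∀ {k} {P : Pred (Fin k) ℓ} (P? : Decidable P) {x} → x ∈ subsetOf P? → P x
∈-subsetOf⁻ P? {x} x∈ = witness (P? x) (trans (sym (lookup∘tabulate (does ∘ P?) x)) ([]=⇒lookup x∈))
  where
  witness : ∀ {A : Set _} (A? : Dec A) → does A? ≡ true → A
  witness (yes a) _  = a
  witness (no _)  ()

disjoint⇒∩≡⊥ : ∀ {k} {p q : Subset k} → (∀ {x} → x ∈ p → x ∉ q) → p ∩ q ≡ ⊥
disjoint⇒∩≡⊥ {p = p} {q} disjoint =
  Empty-unique λ (x , x∈p∩q) → let x∈p , x∈q = x∈p∩q⁻ p q x∈p∩q in disjoint x∈p x∈q

∩≡⊥⇒disjoint : ∀ {k} {p q : Subset k} {x} → p ∩ q ≡ ⊥ → x ∈ p → x ∉ q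
∩≡⊥⇒disjoint p∩q≡⊥ x∈p x∈q = ∉⊥ (subst (_ ∈_) p∩q≡⊥ (x∈p∩q⁺ (x∈p , x∈q)))

module Blocks {m n} {S : ΔSub m n} (closed : CornerClosed S) where
  open Linking S

  Leader : Pred (Fin m) _
  Leader r = Linked r r × (∀ r' → Linked r' r → toℕ r ≤ toℕ r')

  leader? : Decidable Leader
  leader? r = linked? r r ×-dec all? (λ r' → linked? r' r →-dec toℕ r ℕₚ.≤? toℕ r')

  leader-unique : ∀ {r r'} → Leader r → Leader r' → Linked r r' → r ≡ r'
  leader-unique (_ , r-least) (_ , r'-least) rr' =
    toℕ-injective (ℕₚ.≤-antisym (r-least _ (linked-sym rr')) (r'-least _ rr'))

  leader-of : ∀ {i} → Linked i i → ∃ λ r → Leader r × Linked r i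
  leader-of {i} ii
    with ¬∀⟶∃¬-smallest m (λ r → ¬ Linked r i) (λ r → ¬? (linked? r i)) (λ none → none i ii)
  ... | r , ¬¬ri , below = r , (linked-reflˡ ri , least) , ri
    where
    ri : Linked r i
    ri = decidable-stable (linked? r i) ¬¬ri
    least : ∀ r' → Linked r' r → toℕ r ≤ toℕ r'
    least r' r'r with toℕ r ℕₚ.≤? toℕ r'
    ... | yes r≤r' = r≤r'
    ... | no  r≰r' =
      contradiction (linked-trans closed r'r ri) (subst (λ x → ¬ Linked x i) inject≡r' (below (fromℕ< r'<r)))
      where
      r'<r : toℕ r' ℕ.< toℕ r
      r'<r = ℕₚ.≰⇒> r≰r'
      inject≡r' : inject (fromℕ< r'<r) ≡ r'
      inject≡r' = toℕ-injective (trans (toℕ-inject (fromℕ< r'<r)) (toℕ-fromℕ< r'<r))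

  open Enumeration (enumerate leader?) renaming (size to h; elem to leader)

  rows : Fin h → Subset m
  rows k = subsetOf (linked? (leader k))

  cols : Fin h → Subset n
  cols k = subsetOf (∈S? (leader k))

  ∈rows⁺ : ∀ {k a} → Linked (leader k) a → a ∈ rows k
  ∈rows⁺ {k} = ∈-subsetOf⁺ (linked? (leader k))

  ∈rows⁻ : ∀ {k a} → a ∈ rows k → Linked (leader k) a
  ∈rows⁻ {k} = ∈-subsetOf⁻ (linked? (leader k))

  ∈cols⁺ : ∀ {k b} → (leader k , b) ∈Δ S → b ∈ cols k
  ∈cols⁺ {k} = ∈-subsetOf⁺ (∈S? (leader k))

  ∈cols⁻ : ∀ {k b} → b ∈ cols k → (leader k , b) ∈Δ S
  ∈cols⁻ {k} = ∈-subsetOf⁻ (∈S? (leader k))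

  same-leader : ∀ {k l} → Linked (leader k) (leader l) → k ≡ l
  same-leader kl = injective (leader-unique (sound _) (sound _) kl)

  nonempty : ∀ k → IsRectangle (rows k) (cols k)
  nonempty k with sound k
  ... | (b , rb∈S , _) , _ = (leader k , ∈rows⁺ (b , rb∈S , rb∈S)) , (b , ∈cols⁺ rb∈S)

  rows-disjoint : ∀ k l → k ≢ l → rows k ∩ rows l ≡ ⊥
  rows-disjoint k l k≢l = disjoint⇒∩≡⊥ λ a∈k a∈l →
    k≢l (same-leader (linked-trans closed (∈rows⁻ a∈k) (linked-sym (∈rows⁻ a∈l))))

  cols-disjoint : ∀ k l → k ≢ l → cols k ∩ cols l ≡ ⊥
  cols-disjoint k l k≢l = disjoint⇒∩≡⊥ λ b∈k b∈l → k≢l (same-leader (_ , ∈cols⁻ b∈k , ∈cols⁻ b∈l))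

  covers : ∀ i j → (i , j) ∈Δ S → ∃ λ k → i ∈ rows k × j ∈ cols k
  covers i j ij∈S with leader-of (j , ij∈S , ij∈S)
  ... | r , r-leader , ri@(b₀ , rb₀∈S , ib₀∈S) with complete r-leader
  ... | k , refl = k , ∈rows⁺ ri , ∈cols⁺ (closed i r b₀ j ib₀∈S rb₀∈S ij∈S)

  within : ∀ i j → (∃ λ k → i ∈ rows k × j ∈ cols k) → (i , j) ∈Δ S
  within i j (k , i∈k , j∈k) with ∈rows⁻ i∈k
  ... | b₀ , rb₀∈S , ib₀∈S = closed (leader k) i b₀ j rb₀∈S ib₀∈S (∈cols⁻ j∈k)

  decomposition : DisjointRectUnion S
  decomposition = h , rows , cols , nonempty , rows-disjoint , cols-disjoint , λ i j → mk⇔ (covers i j) (within i j)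

same-block : ∀ {h k} {X : Fin h → Subset k} → (∀ k l → k ≢ l → X k ∩ X l ≡ ⊥) →
             ∀ {x k l} → x ∈ X k → x ∈ X l → k ≡ l
same-block disjoint {k = k} {l} x∈k x∈l =
  decidable-stable (k ≟ l) λ k≢l → ∩≡⊥⇒disjoint (disjoint k l k≢l) x∈k x∈l

disjointRectUnion⇒cornerClosed : ∀ {m n} {S : ΔSub m n} → DisjointRectUnion S → CornerClosed S
disjointRectUnion⇒cornerClosed (h , A , B , _ , A-disjoint , B-disjoint , S⇔) a a' b b' ab∈S a'b∈S ab'∈S
  with Equivalence.to (S⇔ a b) ab∈S | Equivalence.to (S⇔ a' b) a'b∈S | Equivalence.to (S⇔ a b') ab'∈S
... | k , a∈k , b∈k | l , a'∈l , b∈l | k' , a∈k' , b'∈k'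
  with refl ← same-block B-disjoint b∈k b∈l | refl ← same-block A-disjoint a∈k a∈k' =
  Equivalence.from (S⇔ a' b') (k , a'∈l , b'∈k')

disjointRectUnion⇔cornerClosed : ∀ {m n} (S : ΔSub m n) → DisjointRectUnion S ⇔ CornerClosed S
disjointRectUnion⇔cornerClosed S = mk⇔ disjointRectUnion⇒cornerClosed Blocks.decomposition

mainTheorem9 : (m n : ℕ) → 1 ≤ m → 1 ≤ n → (S : ΔSub m n) →
    (Complete S ⇔ TriangleClosed S) × (TriangleClosed S ⇔ DisjointRectUnion S)
mainTheorem9 m n _ _ S =
  ⇔-sym (triangleClosed⇔cornerClosed S) ⇔-∘ complete⇔cornerClosed S ,
  ⇔-sym (disjointRectUnion⇔cornerClosed S) ⇔-∘ triangleClosed⇔cornerClosed S
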